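{- The logic $\mathbf{QCKL}^{ - }$ is Kripke incomplete: there is no class $\mathcal{K}$ of (bimodal) Kripke frames such that $\mathbf{QCKL}^{ - }$ equals the set of formulas valid in every frame of $\mathcal{K}$.
   Context: Language: countable set of variables, $\top,\bot,\land,\neg,\forall$, countably many predicate symbols of each arity, two modal operators $\mathsf{E},\mathsf{C}$. $\mathbf{QCKL}^{ - }$ is the set of formulas derivable from: all classical predicate tautologies; $\Box(p\supset q)\supset(\Box p\supset\Box q)$ for $\Box\in\{\mathsf{E},\mathsf{C}\}$; $\mathsf{C}p\supset\mathsf{E}^np$ for each $n\in\omega$; modus ponens; uniform substitution; necessitation for $\mathsf{E}$ and $\mathsf{C}$; generalization; and the $\omega$-rule: from $\gamma\supset\mathsf{E}^n\phi$ for all $n\in\omega$ infer $\gamma\supset\mathsf{C}\phi$. A bimodal Kripke frame is $\langle C,\mathcal{N}_{\mathsf{E}},\mathcal{N}_{\mathsf{C}}\rangle$ with $C\neq\emptyset$ and $\mathcal{N}_{\mathsf{E}},\mathcal{N}_{\mathsf{C}}\colon C\to\mathcal{P}(\mathcal{P}(C))$ such that each $\mathcal{N}(c)$ is upward closed under inclusion and contains $\bigcap\mathcal{N}(c)$. A formula is valid in such a frame if for every nonempty constant domain $\mathcal{D}$, interpretation $\mathcal{I}$ ($P^{\mathcal{I}}(c)\subseteq\mathcal{D}^n$) and assignment $\mathcal{A}$ its valuation equals $C$, where valuation is: atomic via $\mathcal{I}$ pointwise, Boolean connectives set-theoretically, $\forall x\phi\mapsto\bigcap_{d\in\mathcal{D}}v_{[d/x]\mathcal{A}}(\phi)$,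 $\mathsf{E}\phi\mapsto\{c\mid v(\phi)\in\mathcal{N}_{\mathsf{E}}(c)\}$, $\mathsf{C}\phi\mapsto\{c\mid v(\phi)\in\mathcal{N}_{\mathsf{C}}(c)\}$. -}

module Defs where

open import Level using (Level; 0ℓ) renaming (suc to lsuc)
open import Data.Nat using (ℕ; zero; suc; _≡ᵇ_)
open import Data.Bool using (Bool; true; false; if_then_else_; not; _∧_; _∨_; T)
open import Data.Vec using (Vec; []; _∷_; map)
open import Data.Unit using (⊤)
open import Data.Empty using (⊥)
open import Data.Product using (Σ; _×_; _,_)
open import Relation.Nullary using (¬_)

data Fm : Set where
  ⊤'   : Fm
  ⊥'   : Fm
  _∧'_ : Fm → Fm → Fm
  ¬'_  : Fm → Fm
  ∀'   : ℕ → Fm → Fm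
  Pr   : (i n : ℕ) → Vec ℕ n → Fm
  𝐄    : Fm → Fm
  𝐂    : Fm → Fm

infixr 6 _∧'_
infixr 4 _⊃_

_⊃_ : Fm → Fm → Fm
φ ⊃ ψ = ¬' (φ ∧' ¬' ψ)

𝐄^ : ℕ → Fm → Fm
𝐄^ zero    φ = φ
𝐄^ (suc n) φ = 𝐄 (𝐄^ n φ)

occurs : ∀ {n} → ℕ → Vec ℕ n → Bool
occurs x []       = false
occurs x (y ∷ ys) = (x ≡ᵇ y) ∨ occurs x ys

free : ℕ → Fm → Bool
free x ⊤'         = false
free x ⊥'         = false
free x (φ ∧' ψ)   = free x φ ∨ free x ψ
free x (¬' φ)     = free x φ
free x (∀' z φ)   = if x ≡ᵇ z then false else free x φ
free x (Pr i n ys) = occurs x ys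
free x (𝐄 φ)      = free x φ
free x (𝐂 φ)      = free x φ

sub : ℕ → ℕ → Fm → Fm
sub y x ⊤'          = ⊤'
sub y x ⊥'          = ⊥'
sub y x (φ ∧' ψ)    = sub y x φ ∧' sub y x ψ
sub y x (¬' φ)      = ¬' (sub y x φ)
sub y x (∀' z φ)    = if z ≡ᵇ x then ∀' z φ else ∀' z (sub y x φ)
sub y x (Pr i n ys) = Pr i n (map (λ z → if z ≡ᵇ x then y else z) ys)
sub y x (𝐄 φ)       = 𝐄 (sub y x φ)
sub y x (𝐂 φ)       = 𝐂 (sub y x φ)

freeFor : ℕ → ℕ → Fm → Bool
freeFor y x ⊤'          = true
freeFor y x ⊥'          = true
freeFor y x (φ ∧' ψ)    = freeFor y x φ ∧ freeFor y x ψ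
freeFor y x (¬' φ)      = freeFor y x φ
freeFor y x (∀' z φ)    =
  if not (free x (∀' z φ)) then true else (not (z ≡ᵇ y) ∧ freeFor y x φ)
freeFor y x (Pr i n ys) = true
freeFor y x (𝐄 φ)       = freeFor y x φ
freeFor y x (𝐂 φ)       = freeFor y x φ

-- Classical predicate tautologies: theorems of a standard (sound and
-- complete) Hilbert calculus for classical first-order logic over this
-- language (modal formulas 𝐄 φ, 𝐂 φ are treated as atoms by it).

data Taut : Fm → Set where
  ax1  : ∀ φ ψ → Taut (φ ⊃ (ψ ⊃ φ))
  ax2  : ∀ φ ψ χ → Taut ((φ ⊃ (ψ ⊃ χ)) ⊃ ((φ ⊃ ψ) ⊃ (φ ⊃ χ)))
  ax3  : ∀ φ ψ → Taut ((¬' φ ⊃ ¬' ψ) ⊃ (ψ ⊃ φ))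
  ∧e₁  : ∀ φ ψ → Taut ((φ ∧' ψ) ⊃ φ)
  ∧e₂  : ∀ φ ψ → Taut ((φ ∧' ψ) ⊃ ψ)
  ∧i   : ∀ φ ψ → Taut (φ ⊃ (ψ ⊃ (φ ∧' ψ)))
  ⊤i   : Taut ⊤'
  ¬⊥i  : Taut (¬' ⊥')
  ∀e   : ∀ x y φ → T (freeFor y x φ) → Taut (∀' x φ ⊃ sub y x φ)
  ∀d   : ∀ x φ ψ → T (not (free x φ)) →
         Taut (∀' x (φ ⊃ ψ) ⊃ (φ ⊃ ∀' x ψ))
  mp   : ∀ {φ ψ} → Taut (φ ⊃ ψ) → Taut φ → Taut ψ
  gen  : ∀ x {φ} → Taut φ → Taut (∀' x φ)

data QCKL⁻ : Fm → Set where
  taut  : ∀ {φ} → Taut φ → QCKL⁻ φ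
  K𝐄    : ∀ φ ψ → QCKL⁻ (𝐄 (φ ⊃ ψ) ⊃ (𝐄 φ ⊃ 𝐄 ψ))
  K𝐂    : ∀ φ ψ → QCKL⁻ (𝐂 (φ ⊃ ψ) ⊃ (𝐂 φ ⊃ 𝐂 ψ))
  𝐂𝐄    : ∀ φ n → QCKL⁻ (𝐂 φ ⊃ 𝐄^ n φ)
  mp    : ∀ {φ ψ} → QCKL⁻ (φ ⊃ ψ) → QCKL⁻ φ → QCKL⁻ ψ
  nec𝐄  : ∀ {φ} → QCKL⁻ φ → QCKL⁻ (𝐄 φ)
  nec𝐂  : ∀ {φ} → QCKL⁻ φ → QCKL⁻ (𝐂 φ)
  gen   : ∀ x {φ} → QCKL⁻ φ → QCKL⁻ (∀' x φ)
  ω-rule : ∀ {γ φ} → (∀ n → QCKL⁻ (γ ⊃ 𝐄^ n φ)) → QCKL⁻ (γ ⊃ 𝐂 φ)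

-- Bimodal Kripke frames (augmented neighbourhood presentation).
-- Subsets of C are predicates C → Set.

_⊆_ : {C : Set} → (C → Set) → (C → Set) → Set
X ⊆ Y = ∀ d → X d → Y d

-- N(c) is upward closed and contains ⋂ N(c).  Since ⋂ N(c) quantifies
-- over all subsets, it is asked to be represented by some subset Z.
record IsAugmented {C : Set} (N : C → (C → Set) → Set) : Set₁ where
  field
    upward : ∀ c {X Y} → N c X → X ⊆ Y → N c Y
    meet   : ∀ c → Σ (C → Set) λ Z →
               ((∀ d → Z d → (∀ X → N c X → X d)) ×
                (∀ d → (∀ X → N c X → X d) → Z d)) × N c Z

record Frame : Set₁ where
  field
    C        : Set
    inhabited : C
    N𝐄       : C → (C → Set) → Set
    N𝐂       : C → (C → Set) → Set
    aug𝐄     : IsAugmented N𝐄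
    aug𝐂     : IsAugmented N𝐂

_[_↦_] : {D : Set} → (ℕ → D) → ℕ → D → (ℕ → D)
(A [ x ↦ d ]) y = if y ≡ᵇ x then d else A y

module _ (F : Frame) where
  open Frame F

  val : {D : Set} → (I : ℕ → (n : ℕ) → C → Vec D n → Set) →
        (ℕ → D) → Fm → C → Set
  val I A ⊤'          c = ⊤
  val I A ⊥'          c = ⊥
  val I A (φ ∧' ψ)    c = val I A φ c × val I A ψ c
  val I A (¬' φ)      c = ¬ val I A φ c
  val {D} I A (∀' x φ) c = (d : D) → val I (A [ x ↦ d ]) φ c
  val I A (Pr i n ys) c = I i n c (map A ys)
  val I A (𝐄 φ)       c = N𝐄 c (val I A φ)
  val I A (𝐂 φ)       c = N𝐂 c (val I A φ)

  Valid : Fm → Set₁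
  Valid φ = (D : Set) → D → (I : ℕ → (n : ℕ) → C → Vec D n → Set) →
            (A : ℕ → D) → (c : C) → val I A φ c

-- The Barcan formula ∀x 𝐄φ ⊃ 𝐄∀xφ is valid in every Kripke frame: domains are constant, and a
-- neighbourhood system containing its own intersection is closed under arbitrary intersections.
-- It is nevertheless not a theorem of QCKL⁻.  The logic is sound (classically) for filter
-- semantics, where 𝐄φ says that the extension of φ is large and 𝐂φ is read as 𝐄φ ∧ φ, which
-- validates 𝐂φ ⊃ 𝐄ⁿφ and the ω-rule (only its premises for n = 0, 1 are needed).  In the
-- cofinite filter on ℕ, with P(d) true at w iff w ≠ d, every 𝐄P(d) holds but 𝐄∀xP(x) fails.
-- So every class of frames validating all of QCKL⁻ validates a formula outside it.

module Submission where

open import Defs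
open import Level using (0ℓ)
open import Axiom.ExcludedMiddle using (ExcludedMiddle)
open import Axiom.DoubleNegationElimination using (em⇒dne)
open import Data.Bool using (true; false; if_then_else_; not; T)
open import Data.Bool.Properties using (T-∧; T-∨; T-not-≡; ∨-conicalˡ; ∨-conicalʳ)
open import Data.Empty using (⊥; ⊥-elim)
open import Data.Nat using (ℕ; zero; suc; _≡ᵇ_; _≤_; _⊔_)
open import Data.Nat.Properties using (_≟_; ≡⇒≡ᵇ; m≤m⊔n; m≤n⊔m; ≤-trans; ≤-refl; n≮n)
open import Data.Product using (Σ; _×_; _,_; proj₁; proj₂)
open import Data.Product.Function.NonDependent.Propositional using (_×-⇔_)
open import Data.Sum using (inj₁; inj₂)
open import Data.Unit using (⊤; tt)
open import Data.Vec using (Vec; []; _∷_; map)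
open import Data.Vec.Properties using (map-∘; map-cong)
open import Function using (_∘_)
open import Function.Bundles using (_⇔_; mk⇔; Equivalence)
open import Function.Construct.Composition using (_⇔-∘_)
open import Function.Construct.Identity using (⇔-id)
open import Function.Related.TypeIsomorphisms using (¬-cong-⇔)
open import Relation.Nullary using (¬_; proof)
open import Relation.Nullary.Reflects using (Reflects; ofʸ; ofⁿ)
open import Relation.Binary.PropositionalEquality
  using (_≡_; _≢_; refl; sym; trans; cong; cong₂; subst)

open Equivalence using (to; from)

≡ᵇ-reflects : ∀ m n → Reflects (m ≡ n) (m ≡ᵇ n)
≡ᵇ-reflects m n = proof (m ≟ n)

≢⇒≡ᵇ≡false : ∀ {m n} → m ≢ n → (m ≡ᵇ n) ≡ false
≢⇒≡ᵇ≡false {m} {n} m≢n with m ≡ᵇ n | ≡ᵇ-reflects m n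
... | true  | ofʸ m≡n = ⊥-elim (m≢n m≡n)
... | false | _       = refl

≡ᵇ≡false⇒≢ : ∀ {m n} → (m ≡ᵇ n) ≡ false → m ≢ n
≡ᵇ≡false⇒≢ {m} eq refl = subst T eq (≡⇒≡ᵇ m m refl)

free-∀-bound : ∀ x φ → free x (∀' x φ) ≡ false
free-∀-bound x φ with x ≡ᵇ x | ≡ᵇ-reflects x x
... | true  | _       = refl
... | false | ofⁿ x≢x = ⊥-elim (x≢x refl)

free-∀-other : ∀ {x z} φ → x ≢ z → free x (∀' z φ) ≡ free x φ
free-∀-other φ x≢z rewrite ≢⇒≡ᵇ≡false x≢z = refl

sub-∀-other : ∀ {x z} y φ → z ≢ x → sub y x (∀' z φ) ≡ ∀' z (sub y x φ)
sub-∀-other y φ z≢x rewrite ≢⇒≡ᵇ≡false z≢x = refl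

rename : ℕ → ℕ → ℕ → ℕ
rename y x z = if z ≡ᵇ x then y else z

rename-fresh : ∀ {n} x y (zs : Vec ℕ n) → occurs x zs ≡ false → map (rename y x) zs ≡ zs
rename-fresh x y []       _  = refl
rename-fresh x y (z ∷ zs) fr
  rewrite ≢⇒≡ᵇ≡false {z} {x} (λ z≡x → ≡ᵇ≡false⇒≢ (∨-conicalˡ _ _ fr) (sym z≡x))
  = cong (z ∷_) (rename-fresh x y zs (∨-conicalʳ _ _ fr))

sub-fresh : ∀ x y φ → free x φ ≡ false → sub y x φ ≡ φ
sub-fresh x y ⊤'          fr = refl
sub-fresh x y ⊥'          fr = refl
sub-fresh x y (φ ∧' ψ)    fr = cong₂ _∧'_ (sub-fresh x y φ (∨-conicalˡ _ _ fr)) (sub-fresh x y ψ (∨-conicalʳ _ _ fr))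
sub-fresh x y (¬' φ)      fr = cong ¬'_ (sub-fresh x y φ fr)
sub-fresh x y (∀' z φ)    fr with z ≡ᵇ x | ≡ᵇ-reflects z x
... | true  | _       = refl
... | false | ofⁿ z≢x = cong (∀' z) (sub-fresh x y φ (trans (sym (free-∀-other φ (z≢x ∘ sym))) fr))
sub-fresh x y (Pr i n zs) fr = cong (Pr i n) (rename-fresh x y zs fr)
sub-fresh x y (𝐄 φ)       fr = cong 𝐄 (sub-fresh x y φ fr)
sub-fresh x y (𝐂 φ)       fr = cong 𝐂 (sub-fresh x y φ fr)

_≈[_]_ : {D : Set} → (ℕ → D) → Fm → (ℕ → D) → Set
A ≈[ φ ] B = ∀ v → T (free v φ) → A v ≡ B v

module _ {D : Set} where

  ↦-other : ∀ (A : ℕ → D) {x v} d → v ≢ x → (A [ x ↦ d ]) v ≡ A v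
  ↦-other A d v≢x rewrite ≢⇒≡ᵇ≡false v≢x = refl

  ↦-≈-fresh : ∀ {x} φ (A : ℕ → D) d → free x φ ≡ false → A ≈[ φ ] (A [ x ↦ d ])
  ↦-≈-fresh φ A d fr v v-free =
    sym (↦-other A d λ { refl → subst T fr v-free })

  ↦-≈-∀ : ∀ {z} φ {A B : ℕ → D} d → A ≈[ ∀' z φ ] B → (A [ z ↦ d ]) ≈[ φ ] (B [ z ↦ d ])
  ↦-≈-∀ {z} φ d A≈B v v-free with v ≡ᵇ z | ≡ᵇ-reflects v z
  ... | true  | _       = refl
  ... | false | ofⁿ v≢z = A≈B v (subst T (sym (free-∀-other φ v≢z)) v-free)

  ↦-swap : ∀ (A : ℕ → D) {x y z} d → x ≢ z → y ≢ z →
           ∀ v → ((A [ z ↦ d ]) [ x ↦ (A [ z ↦ d ]) y ]) v ≡ ((A [ x ↦ A y ]) [ z ↦ d ]) v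
  ↦-swap A {x} {y} {z} d x≢z y≢z v rewrite ↦-other A d y≢z
    with v ≡ᵇ x | ≡ᵇ-reflects v x | v ≡ᵇ z | ≡ᵇ-reflects v z
  ... | true  | ofʸ refl | true  | ofʸ refl = ⊥-elim (x≢z refl)
  ... | true  | _        | false | _        = refl
  ... | false | _        | true  | _        = refl
  ... | false | _        | false | _        = refl

  map-agree : ∀ {n} (A B : ℕ → D) (zs : Vec ℕ n) →
              (∀ v → T (occurs v zs) → A v ≡ B v) → map A zs ≡ map B zs
  map-agree A B []       _    = refl
  map-agree A B (z ∷ zs) A≈B = cong₂ _∷_
    (A≈B z (from T-∨ (inj₁ (≡⇒≡ᵇ z z refl))))
    (map-agree A B zs λ v occ → A≈B v (from T-∨ (inj₂ occ)))

  map-rename : ∀ {n} (A : ℕ → D) x y (zs : Vec ℕ n) →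
               map A (map (rename y x) zs) ≡ map (A [ x ↦ A y ]) zs
  map-rename A x y zs = trans (sym (map-∘ A (rename y x) zs)) (map-cong A∘rename zs)
    where
    A∘rename : ∀ z → A (rename y x z) ≡ (A [ x ↦ A y ]) z
    A∘rename z with z ≡ᵇ x
    ... | true  = refl
    ... | false = refl

Π-cong-⇔ : ∀ {D : Set} {P Q : D → Set} → (∀ d → P d ⇔ Q d) → (∀ d → P d) ⇔ (∀ d → Q d)
Π-cong-⇔ P⇔Q = mk⇔ (λ p d → to (P⇔Q d) (p d)) (λ q d → from (P⇔Q d) (q d))

⊃-intro : {P Q : Set} → (P → Q) → ¬ (P × ¬ Q)
⊃-intro f (p , ¬q) = ¬q (f p)

record Filter (W : Set) : Set₁ where
  field
    Large    : (W → Set) → Set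
    whole    : Large (λ _ → ⊤)
    upward   : ∀ {X Y} → Large X → X ⊆ Y → Large Y
    ∩-closed : ∀ {X Y} → Large X → Large Y → Large (λ w → X w × Y w)

  everywhere⇒Large : ∀ {X} → (∀ w → X w) → Large X
  everywhere⇒Large X-all = upward whole λ w _ → X-all w

  Large-cong : ∀ {X Y} → (∀ w → X w ⇔ Y w) → Large X ⇔ Large Y
  Large-cong X⇔Y = mk⇔ (λ l → upward l λ w → to (X⇔Y w)) (λ l → upward l λ w → from (X⇔Y w))

module FilterSemantics {W D : Set} (𝓕 : Filter W) (I : ℕ → (n : ℕ) → W → Vec D n → Set) where
  open Filter 𝓕

  ⟦_⟧ : Fm → (ℕ → D) → W → Set
  ⟦ ⊤' ⟧        A w = ⊤
  ⟦ ⊥' ⟧        A w = ⊥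
  ⟦ φ ∧' ψ ⟧    A w = ⟦ φ ⟧ A w × ⟦ ψ ⟧ A w
  ⟦ ¬' φ ⟧      A w = ¬ ⟦ φ ⟧ A w
  ⟦ ∀' x φ ⟧    A w = (d : D) → ⟦ φ ⟧ (A [ x ↦ d ]) w
  ⟦ Pr i n zs ⟧ A w = I i n w (map A zs)
  ⟦ 𝐄 φ ⟧       A w = Large (⟦ φ ⟧ A)
  ⟦ 𝐂 φ ⟧       A w = Large (⟦ φ ⟧ A) × ⟦ φ ⟧ A w

  coincidence : ∀ φ {A B} → A ≈[ φ ] B → ∀ w → ⟦ φ ⟧ A w ⇔ ⟦ φ ⟧ B w
  coincidence ⊤'          A≈B w = ⇔-id _
  coincidence ⊥'          A≈B w = ⇔-id _
  coincidence (φ ∧' ψ)    A≈B w =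
    coincidence φ (λ v → A≈B v ∘ from T-∨ ∘ inj₁) w ×-⇔ coincidence ψ (λ v → A≈B v ∘ from T-∨ ∘ inj₂) w
  coincidence (¬' φ)      A≈B w = ¬-cong-⇔ (coincidence φ A≈B w)
  coincidence (∀' x φ)    A≈B w = Π-cong-⇔ λ d → coincidence φ (↦-≈-∀ φ d A≈B) w
  coincidence (Pr i n zs) {A} {B} A≈B w =
    mk⇔ (subst (I i n w) A≡B) (subst (I i n w) (sym A≡B))
    where A≡B = map-agree A B zs A≈B
  coincidence (𝐄 φ)       A≈B w = Large-cong (coincidence φ A≈B)
  coincidence (𝐂 φ)       A≈B w = Large-cong (coincidence φ A≈B) ×-⇔ coincidence φ A≈B w

  substitution-fresh : ∀ x y φ {A} → free x φ ≡ false →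
                       ∀ w → ⟦ sub y x φ ⟧ A w ⇔ ⟦ φ ⟧ (A [ x ↦ A y ]) w
  substitution-fresh x y φ {A} fr w rewrite sub-fresh x y φ fr =
    coincidence φ (↦-≈-fresh φ A (A y) fr) w

  substitution : ∀ x y φ {A} → T (freeFor y x φ) →
                 ∀ w → ⟦ sub y x φ ⟧ A w ⇔ ⟦ φ ⟧ (A [ x ↦ A y ]) w
  substitution x y ⊤'          ff w = ⇔-id _
  substitution x y ⊥'          ff w = ⇔-id _
  substitution x y (φ ∧' ψ)    ff w =
    substitution x y φ (proj₁ (to T-∧ ff)) w ×-⇔ substitution x y ψ (proj₂ (to T-∧ ff)) w
  substitution x y (¬' φ)      ff w = ¬-cong-⇔ (substitution x y φ ff w)
  -- In the true clause, with-abstraction also reduces ff to T (not (z ≡ᵇ y) ∧ freeFor y x φ).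
  substitution x y (∀' z φ) {A} ff w with free x (∀' z φ) in fr
  ... | false = substitution-fresh x y (∀' z φ) fr w
  ... | true  = subst (λ ψ → ⟦ ψ ⟧ A w ⇔ ⟦ ∀' z φ ⟧ (A [ x ↦ A y ]) w)
                      (sym (sub-∀-other y φ (x≢z ∘ sym)))
                      (Π-cong-⇔ λ d → coincidence φ (λ v _ → ↦-swap A d x≢z y≢z v) w
                                        ⇔-∘ substitution x y φ ffφ w)
    where
    x≢z : x ≢ z
    x≢z refl with () ← trans (sym fr) (free-∀-bound x φ)
    y≢z : y ≢ z
    y≢z = ≡ᵇ≡false⇒≢ (to T-not-≡ (proj₁ (to T-∧ ff))) ∘ sym
    ffφ : T (freeFor y x φ)
    ffφ = proj₂ (to T-∧ ff)
  substitution x y (Pr i n zs) {A} ff w =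
    mk⇔ (subst (I i n w) (map-rename A x y zs)) (subst (I i n w) (sym (map-rename A x y zs)))
  substitution x y (𝐄 φ)       ff w = Large-cong (substitution x y φ ff)
  substitution x y (𝐂 φ)       ff w = Large-cong (substitution x y φ ff) ×-⇔ substitution x y φ ff w

  module Soundness (em : ExcludedMiddle 0ℓ) where

    ⊃-elim : {P Q : Set} → ¬ (P × ¬ Q) → P → Q
    ⊃-elim ¬[p∧¬q] p = em⇒dne em λ ¬q → ¬[p∧¬q] (p , ¬q)

    taut-sound : ∀ {φ} → Taut φ → ∀ A w → ⟦ φ ⟧ A w
    taut-sound (ax1 φ ψ)   A w = ⊃-intro λ a → ⊃-intro λ _ → a
    taut-sound (ax2 φ ψ χ) A w = ⊃-intro λ f → ⊃-intro λ g → ⊃-intro λ a →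
      ⊃-elim (⊃-elim f a) (⊃-elim g a)
    taut-sound (ax3 φ ψ)   A w = ⊃-intro λ f → ⊃-intro λ b →
      em⇒dne em λ ¬a → ⊃-elim f ¬a b
    taut-sound (∧e₁ φ ψ)   A w = ⊃-intro proj₁
    taut-sound (∧e₂ φ ψ)   A w = ⊃-intro proj₂
    taut-sound (∧i φ ψ)    A w = ⊃-intro λ a → ⊃-intro λ b → a , b
    taut-sound ⊤i          A w = tt
    taut-sound ¬⊥i         A w = λ ()
    taut-sound (∀e x y φ ff) A w = ⊃-intro λ ∀φ → from (substitution x y φ ff w) (∀φ (A y))
    taut-sound (∀d x φ ψ fr) A w = ⊃-intro λ ∀φ⊃ψ → ⊃-intro λ a d →
      ⊃-elim (∀φ⊃ψ d) (to (coincidence φ (↦-≈-fresh φ A d (to T-not-≡ fr)) w) a)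
    taut-sound (mp f a)    A w = ⊃-elim (taut-sound f A w) (taut-sound a A w)
    taut-sound (gen x t)   A w = λ d → taut-sound t (A [ x ↦ d ]) w

    𝐄^suc-everywhere : ∀ φ {A} → Large (⟦ φ ⟧ A) → ∀ n w → ⟦ 𝐄^ (suc n) φ ⟧ A w
    𝐄^suc-everywhere φ l zero    w = l
    𝐄^suc-everywhere φ l (suc n) w = everywhere⇒Large (𝐄^suc-everywhere φ l n)

    sound : ∀ {φ} → QCKL⁻ φ → ∀ A w → ⟦ φ ⟧ A w
    sound (taut t)       A w = taut-sound t A w
    sound (K𝐄 φ ψ)       A w = ⊃-intro λ l₁ → ⊃-intro λ l₂ →
      upward (∩-closed l₁ l₂) λ w′ (f , a) → ⊃-elim f a
    sound (K𝐂 φ ψ)       A w = ⊃-intro λ (l₁ , f) → ⊃-intro λ (l₂ , a) →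
      upward (∩-closed l₁ l₂) (λ w′ (f′ , a′) → ⊃-elim f′ a′) , ⊃-elim f a
    sound (𝐂𝐄 φ zero)    A w = ⊃-intro proj₂
    sound (𝐂𝐄 φ (suc n)) A w = ⊃-intro λ (l , _) → 𝐄^suc-everywhere φ l n w
    sound (mp f a)       A w = ⊃-elim (sound f A w) (sound a A w)
    sound (nec𝐄 d)       A w = everywhere⇒Large (sound d A)
    sound (nec𝐂 d)       A w = everywhere⇒Large (sound d A) , sound d A w
    sound (gen x d)      A w = λ e → sound d (A [ x ↦ e ]) w
    sound (ω-rule h)     A w = ⊃-intro λ g → ⊃-elim (sound (h 1) A w) g , ⊃-elim (sound (h 0) A w) g

barcan : ℕ → Fm → Fm
barcan x φ = ∀' x (𝐄 φ) ⊃ 𝐄 (∀' x φ)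

augmented-⋂-closed : ∀ {C D : Set} {N : C → (C → Set) → Set} → IsAugmented N →
                     ∀ c {X : D → C → Set} → (∀ d → N c (X d)) → N c (λ c′ → ∀ d → X d c′)
augmented-⋂-closed aug c X-large with IsAugmented.meet aug c
... | Z , (Z⊆⋂ , _) , Z-large =
  IsAugmented.upward aug c Z-large λ c′ z d → Z⊆⋂ c′ z _ (X-large d)

barcan-valid : ∀ F x φ → Valid F (barcan x φ)
barcan-valid F x φ _ _ _ _ c (h , ¬h) = ¬h (augmented-⋂-closed (Frame.aug𝐄 F) c h)

cofinite : Filter ℕ
cofinite = record
  { Large    = λ X → Σ ℕ λ m → ∀ w → m ≤ w → X w
  ; whole    = 0 , _
  ; upward   = λ (m , X-from-m) X⊆Y → m , λ w m≤w → X⊆Y w (X-from-m w m≤w)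
  ; ∩-closed = λ (m , X-from-m) (k , Y-from-k) → m ⊔ k , λ w m⊔k≤w →
      X-from-m w (≤-trans (m≤m⊔n m k) m⊔k≤w) , Y-from-k w (≤-trans (m≤n⊔m m k) m⊔k≤w)
  }

off-diagonal : ℕ → (n : ℕ) → ℕ → Vec ℕ n → Set
off-diagonal _ _ w []      = ⊤
off-diagonal _ _ w (d ∷ _) = w ≢ d

P₀ : Fm
P₀ = Pr 0 1 (0 ∷ [])

barcan-underivable : ExcludedMiddle 0ℓ → ¬ QCKL⁻ (barcan 0 P₀)
barcan-underivable em ⊢barcan =
  Soundness.sound em ⊢barcan (λ _ → 0) 0 (co-singletons-large , ∅-not-large)
  where
  open FilterSemantics cofinite off-diagonal
  co-singletons-large : ∀ d → Filter.Large cofinite (λ w → w ≢ d)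
  co-singletons-large d = suc d , λ { w d<w refl → n≮n d d<w }
  ∅-not-large : ¬ Filter.Large cofinite (λ w → ∀ d → w ≢ d)
  ∅-not-large (m , h) = h m ≤-refl m refl

theorem7p8 : ExcludedMiddle 0ℓ →
    ¬ (Σ (Frame → Set₁) λ 𝒦 →
         (∀ φ → QCKL⁻ φ → ∀ F → 𝒦 F → Valid F φ) ×
         (∀ φ → (∀ F → 𝒦 F → Valid F φ) → QCKL⁻ φ))
theorem7p8 em (𝒦 , _ , complete) =
  barcan-underivable em (complete (barcan 0 P₀) λ F _ → barcan-valid F 0 P₀)
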